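{- If $G$ is $\delta$-hyperbolic, then $\operatorname{pg}(G)\le 4\delta$.
   Context: Graphs are finite, connected, unweighted, undirected and simple; $d_G$ is shortest-path distance; $\Pr(x,S)=\{u\in S\mid d_G(u,x)=\min_{w\in S}d_G(w,x)\}$. $G$ is $\delta$-hyperbolic if for any four vertices $u,v,w,x$, the two larger of the sums $d_G(u,v)+d_G(w,x)$, $d_G(u,w)+d_G(v,x)$, $d_G(u,x)+d_G(v,w)$ differ by at most $2\delta$. Projection gap: for an integer $\gamma\ge0$, $G$ has projection gap at most $\gamma$ if for every shortest path $P=(v_0,\dots,v_l)$ (with $d_G(v_0,v_i)=i$), every vertex $x$ and every $v_i,v_k\in\Pr(x,P)$ with $i<k$, $d_G(v_i,v_k)>\gamma+1$ implies there is $v_j\in\Pr(x,P)$ with $i<j<k$; $\operatorname{pg}(G)$ is the least such $\gamma$, and $\operatorname{pg}(G)\le 4\delta$ means this property holds with $\gamma$ replaced by $4\delta$.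
   Formalization: The hyperbolicity constant δ is taken to be rational. -}

module Defs where

open import Data.Nat using (ℕ; zero; suc; _≤_; _<_; _⊔_; _⊓_; _∸_) renaming (_+_ to _N+_)
open import Data.Fin using (Fin; toℕ; inject₁) renaming (zero to fzero; suc to fsuc)
open import Data.Product using (Σ; _×_; ∃)
open import Data.Integer using (+_)
open import Data.Rational as ℚ using (ℚ; _/_)
open import Relation.Binary.PropositionalEquality using (_≡_)
open import Relation.Nullary using (¬_)

record Graph : Set₁ where
  field
    n     : ℕ
    Adj   : Fin n → Fin n → Set
    sym   : ∀ {u v} → Adj u v → Adj v u
    irrefl : ∀ {u} → ¬ Adj u u
open Graph public

data Walk (G : Graph) : Fin (n G) → Fin (n G) → ℕ → Set where
  here : ∀ {u} → Walk G u u 0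
  step : ∀ {u v w k} → Adj G u v → Walk G v w k → Walk G u w (suc k)

Connected : Graph → Set
Connected G = ∀ u v → ∃ λ k → Walk G u v k

IsDistance : (G : Graph) → (Fin (n G) → Fin (n G) → ℕ) → Set
IsDistance G d = ∀ u v → Walk G u v (d u v) × (∀ k → Walk G u v k → d u v ≤ k)

ℕ→ℚ : ℕ → ℚ
ℕ→ℚ m = (+ m) / 1

-- For three numbers, the difference between the largest and the middle one
-- (i.e. the two larger ones).
median3 : ℕ → ℕ → ℕ → ℕ
median3 a b c = (a ⊓ b) ⊔ ((a ⊔ b) ⊓ c)

gap3 : ℕ → ℕ → ℕ → ℕ
gap3 a b c = (a ⊔ b ⊔ c) ∸ median3 a b c

Hyperbolic : (G : Graph) → (Fin (n G) → Fin (n G) → ℕ) → ℚ → Set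
Hyperbolic G d δ = ∀ u v w x →
  ℕ→ℚ (gap3 (d u v N+ d w x) (d u w N+ d v x) (d u x N+ d v w))
    ℚ.≤ (+ 2 / 1) ℚ.* δ

IsShortestPath : (G : Graph) → (Fin (n G) → Fin (n G) → ℕ) →
                 (l : ℕ) → (Fin (suc l) → Fin (n G)) → Set
IsShortestPath G d l P =
  (∀ (i : Fin l) → Adj G (P (inject₁ i)) (P (fsuc i))) ×
  (∀ (i : Fin (suc l)) → d (P fzero) (P i) ≡ toℕ i)

InProj : (G : Graph) → (Fin (n G) → Fin (n G) → ℕ) →
         (l : ℕ) → (Fin (suc l) → Fin (n G)) → Fin (n G) → Fin (suc l) → Set
InProj G d l P x i = ∀ (j : Fin (suc l)) → d (P i) x ≤ d (P j) x

ProjectionGapAtMost : (G : Graph) → (Fin (n G) → Fin (n G) → ℕ) → ℚ → Set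
ProjectionGapAtMost G d γ =
  ∀ (l : ℕ) (P : Fin (suc l) → Fin (n G)) → IsShortestPath G d l P →
  ∀ (x : Fin (n G)) (i k : Fin (suc l)) → toℕ i < toℕ k →
  InProj G d l P x i → InProj G d l P x k →
  γ ℚ.+ ℚ.1ℚ ℚ.< ℕ→ℚ (d (P i) (P k)) →
  Σ (Fin (suc l)) λ j → toℕ i < toℕ j × toℕ j < toℕ k × InProj G d l P x j

-- Let v_i, v_k be projections of x on a geodesic P with d(v_i,v_k) = L > 4δ + 1, and let
-- v_j be the vertex at distance h = ⌈L/2⌉ from v_i and f = ⌊L/2⌋ from v_k. If v_j were
-- strictly farther from x than r = d(v_i,x) ≥ d(v_k,x), the four-point sums for
-- v_i, v_k, v_j, x would be at least L + r + 1 for the pair {v_i v_k, v_j x} and at most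
-- r + h for the two others, so 2δ ≥ L + 1 − h = f + 1, i.e. 4δ + 1 ≥ 2f + 3 > L.
-- Hence v_j is a projection of x strictly between v_i and v_k.
module Submission where

open import Defs hiding (sym)
open import Data.Rational using (ℚ; _*_; _/_)
open import Data.Integer using (+_)
open import Data.Nat using (ℕ)
open import Data.Fin using (Fin)

import Data.Rational as ℚ
import Data.Rational.Properties as ℚP
import Data.Integer as ℤ
import Data.Integer.Properties as ℤP
open import Data.Nat using (zero; suc; _+_; _≤_; _<_; _∸_; _⊔_; z≤n; s≤s; z<s; ⌊_/2⌋; ⌈_/2⌉; _≤?_)
open import Data.Nat.Properties
open import Data.Nat.Coprimality using (1-coprimeTo) renaming (sym to coprime-sym)
open import Data.Nat.Solver using (module +-*-Solver)
open import Data.Fin using (toℕ; fromℕ<) renaming (zero to fzero)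
open import Data.Fin.Properties using (toℕ-injective; toℕ-fromℕ<; toℕ<n; toℕ-inject₁)
open import Data.Product using (Σ; ∃₂; _×_; _,_; proj₁; proj₂)
open import Data.Empty using (⊥; ⊥-elim)
open import Relation.Nullary using (yes; no)
open import Relation.Binary.PropositionalEquality
  using (_≡_; refl; sym; trans; cong; cong₂; subst; subst₂; module ≡-Reasoning)

ℕ→ℚ-≡-mkℚ : ∀ m → ℕ→ℚ m ≡ ℚ.mkℚ (+ m) 0 (coprime-sym (1-coprimeTo m))
ℕ→ℚ-≡-mkℚ m = ℚP.↥p/↧p≡p _

ℕ→ℚ-mono-≤ : ∀ {m n} → m ≤ n → ℕ→ℚ m ℚ.≤ ℕ→ℚ n
ℕ→ℚ-mono-≤ {m} {n} m≤n rewrite ℕ→ℚ-≡-mkℚ m | ℕ→ℚ-≡-mkℚ n =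
  ℚ.*≤* (subst₂ ℤ._≤_ (sym (ℤP.*-identityʳ (+ m))) (sym (ℤP.*-identityʳ (+ n))) (ℤ.+≤+ m≤n))

ℕ→ℚ-homo-+ : ∀ m n → ℕ→ℚ (m + n) ≡ ℕ→ℚ m ℚ.+ ℕ→ℚ n
ℕ→ℚ-homo-+ m n rewrite ℕ→ℚ-≡-mkℚ m | ℕ→ℚ-≡-mkℚ n =
  sym (ℚP./-cong {p₁ = + m ℤ.* + 1 ℤ.+ + n ℤ.* + 1} {q₁ = 1}
        (cong₂ ℤ._+_ (ℤP.*-identityʳ (+ m)) (ℤP.*-identityʳ (+ n))) refl)

double+1<-of-≤-2δ : ∀ δ g D → ℕ→ℚ g ℚ.≤ (+ 2 / 1) * δ →
                    (+ 4 / 1) * δ ℚ.+ ℚ.1ℚ ℚ.< ℕ→ℚ D → suc (g + g) < D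
double+1<-of-≤-2δ δ g D g≤2δ 4δ+1<D =
  ≰⇒> (λ D≤ → ℚP.<-irrefl refl (ℚP.<-≤-trans 4δ+1<D (embed D≤)))
  where
  open ℚP.≤-Reasoning
  embed : D ≤ suc (g + g) → ℕ→ℚ D ℚ.≤ (+ 4 / 1) * δ ℚ.+ ℚ.1ℚ
  embed D≤ = begin
    ℕ→ℚ D                                    ≤⟨ ℕ→ℚ-mono-≤ D≤ ⟩
    ℕ→ℚ (suc (g + g))                        ≡⟨ cong ℕ→ℚ (+-comm 1 (g + g)) ⟩
    ℕ→ℚ (g + g + 1)                          ≡⟨ ℕ→ℚ-homo-+ (g + g) 1 ⟩
    ℕ→ℚ (g + g) ℚ.+ ℚ.1ℚ                     ≡⟨ cong (ℚ._+ ℚ.1ℚ) (ℕ→ℚ-homo-+ g g) ⟩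
    (ℕ→ℚ g ℚ.+ ℕ→ℚ g) ℚ.+ ℚ.1ℚ               ≤⟨ ℚP.+-monoˡ-≤ ℚ.1ℚ (ℚP.+-mono-≤ g≤2δ g≤2δ) ⟩
    ((+ 2 / 1) * δ ℚ.+ (+ 2 / 1) * δ) ℚ.+ ℚ.1ℚ ≡⟨ cong (ℚ._+ ℚ.1ℚ) (sym (ℚP.*-distribʳ-+ δ (+ 2 / 1) (+ 2 / 1))) ⟩
    (+ 4 / 1) * δ ℚ.+ ℚ.1ℚ                   ∎

gap3-≡ : ∀ {A B C} → B ≤ A → C ≤ A → gap3 A B C ≡ A ∸ (B ⊔ C)
gap3-≡ B≤A C≤A
  rewrite m≥n⇒m⊓n≡n B≤A | m≥n⇒m⊔n≡m B≤A | m≥n⇒m⊓n≡n C≤A | m≥n⇒m⊔n≡m C≤A = refl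

∸-≤-gap3 : ∀ {A B C} M → B ≤ M → C ≤ M → A ∸ M ≤ gap3 A B C
∸-≤-gap3 {A} M B≤M C≤M with A ≤? M
... | yes A≤M = ≤-trans (≤-reflexive (m≤n⇒m∸n≡0 A≤M)) z≤n
... | no A≰M = subst (A ∸ M ≤_) (sym (gap3-≡ (≤-trans B≤M M≤A) (≤-trans C≤M M≤A)))
                     (∸-monoʳ-≤ A (⊔-lub B≤M C≤M))
  where
  M≤A : M ≤ A
  M≤A = <⇒≤ (≰⇒> A≰M)

split-halves : ∀ L → 2 ≤ L → ∃₂ λ h f → L ≡ suc h + suc f × f ≤ h × h ≤ suc f
split-halves (suc zero) (s≤s ())
split-halves (suc (suc L)) _ =
  ⌈ L /2⌉ , ⌊ L /2⌋ , L-split , ⌊n/2⌋≤⌈n/2⌉ L , ⌊n/2⌋-mono (n≤1+n (suc L))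
  where
  L-split : suc (suc L) ≡ suc ⌈ L /2⌉ + suc ⌊ L /2⌋
  L-split = cong suc (trans (cong suc (trans (sym (⌊n/2⌋+⌈n/2⌉≡n L)) (+-comm ⌊ L /2⌋ ⌈ L /2⌉)))
                            (sym (+-suc ⌈ L /2⌉ ⌊ L /2⌋)))

halves-contradiction : ∀ {h f g} → h ≤ suc f → suc f ≤ g → suc (g + g) < h + f → ⊥
halves-contradiction {h} {f} {g} h≤1+f 1+f≤g 2g+1<L = <-irrefl refl (begin-strict
  h + f       ≤⟨ +-monoˡ-≤ f h≤1+f ⟩
  suc f + f   ≤⟨ +-mono-≤ 1+f≤g (≤-trans (n≤1+n f) 1+f≤g) ⟩
  g + g       <⟨ n<1+n (g + g) ⟩
  suc (g + g) <⟨ 2g+1<L ⟩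
  h + f       ∎)
  where open ≤-Reasoning

farther-sum-bound : ∀ {r s} h f → r < s → suc f ≤ (h + f + s) ∸ (r + h)
farther-sum-bound {r} {s} h f r<s = m+n≤o⇒m≤o∸n (suc f) (begin
  suc f + (r + h)   ≡⟨ rearrange f r h ⟩
  h + f + suc r     ≤⟨ +-monoʳ-≤ (h + f) r<s ⟩
  h + f + s         ∎)
  where
  open ≤-Reasoning
  open +-*-Solver
  rearrange : ∀ f r h → suc f + (r + h) ≡ h + f + suc r
  rearrange = solve 3 (λ f r h → (con 1 :+ f) :+ (r :+ h) := h :+ f :+ (con 1 :+ r)) refl

fourPointGap : {V : Set} → (V → V → ℕ) → V → V → V → V → ℕ
fourPointGap d u v w x = gap3 (d u v + d w x) (d u w + d v x) (d u x + d v w)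

module _ {G : Graph} where

  _++ᵂ_ : ∀ {u v w a b} → Walk G u v a → Walk G v w b → Walk G u w (a + b)
  here     ++ᵂ q = q
  step e p ++ᵂ q = step e (p ++ᵂ q)

  reverseᵂ : ∀ {u v a} → Walk G u v a → Walk G v u a
  reverseᵂ here = here
  reverseᵂ {a = suc a} (step e p) =
    subst (Walk G _ _) (+-comm a 1) (reverseᵂ p ++ᵂ step (Graph.sym G e) here)

module Distance (G : Graph) {d : Fin (n G) → Fin (n G) → ℕ} (isD : IsDistance G d) where

  d-walk : ∀ u v → Walk G u v (d u v)
  d-walk u v = proj₁ (isD u v)

  d-≤-walk : ∀ {u v k} → Walk G u v k → d u v ≤ k
  d-≤-walk = proj₂ (isD _ _) _

  d-sym : ∀ u v → d u v ≡ d v u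
  d-sym u v = ≤-antisym (d-≤-walk (reverseᵂ (d-walk v u))) (d-≤-walk (reverseᵂ (d-walk u v)))

  d-triangle : ∀ u v w → d u w ≤ d u v + d v w
  d-triangle u v w = d-≤-walk (d-walk u v ++ᵂ d-walk v w)

  module _ {l : ℕ} {P : Fin (suc l) → Fin (n G)} (sp : IsShortestPath G d l P) where

    path-walk : ∀ t {a b} → toℕ a + t ≡ toℕ b → Walk G (P a) (P b) t
    path-walk zero {a} a+0≡b =
      subst (λ c → Walk G (P a) (P c) 0) (toℕ-injective (trans (sym (+-identityʳ (toℕ a))) a+0≡b)) here
    path-walk (suc t) {a} {b} a+1+t≡b =
      subst (λ c → Walk G (P c) (P b) (suc t)) (toℕ-injective (trans (toℕ-inject₁ c) toℕc≡a))
        (step (proj₁ sp c) (path-walk t (trans (cong (λ m → suc m + t) toℕc≡a)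
                                               (trans (sym (+-suc (toℕ a) t)) a+1+t≡b))))
      where
      a<l : toℕ a < l
      a<l = ≤-trans (s≤s (m≤m+n (toℕ a) t))
              (≤-trans (≤-reflexive (trans (sym (+-suc (toℕ a) t)) a+1+t≡b)) (≤-pred (toℕ<n b)))
      c : Fin l
      c = fromℕ< a<l
      toℕc≡a : toℕ c ≡ toℕ a
      toℕc≡a = toℕ-fromℕ< a<l

    d-path-≤ : ∀ {a b} t → toℕ a + t ≡ toℕ b → d (P a) (P b) ≤ t
    d-path-≤ t a+t≡b = d-≤-walk (path-walk t a+t≡b)

    d-path : ∀ {a b} → toℕ a ≤ toℕ b → d (P a) (P b) ≡ toℕ b ∸ toℕ a
    d-path {a} {b} a≤b = ≤-antisym (d-path-≤ _ (m+[n∸m]≡n a≤b)) (m≤n+o⇒m∸n≤o (toℕ b) (toℕ a) b≤a+d)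
      where
      b≤a+d : toℕ b ≤ toℕ a + d (P a) (P b)
      b≤a+d = subst₂ _≤_ (proj₂ sp b) (cong (_+ d (P a) (P b)) (proj₂ sp a))
                (d-triangle (P fzero) (P a) (P b))

    d-path-+ : ∀ {i j k : Fin (suc l)} h f → toℕ j ≡ toℕ i + h → toℕ k ≡ toℕ j + f →
               d (P i) (P k) ≡ h + f
    d-path-+ {i} {j} {k} h f j≡i+h k≡j+f =
      trans (d-path (≤-trans (m≤m+n (toℕ i) (h + f)) (≤-reflexive (sym k≡i+h+f))))
            (trans (cong (_∸ toℕ i) k≡i+h+f) (m+n∸m≡n (toℕ i) (h + f)))
      where
      k≡i+h+f : toℕ k ≡ toℕ i + (h + f)
      k≡i+h+f = trans k≡j+f (trans (cong (_+ f) j≡i+h) (+-assoc (toℕ i) h f))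

    farther-midpoint-gap :
      ∀ {x} {i j k : Fin (suc l)} h f → toℕ j ≡ toℕ i + h → toℕ k ≡ toℕ j + f → f ≤ h →
      d (P k) x ≤ d (P i) x → d (P i) x < d (P j) x →
      suc f ≤ fourPointGap d (P i) (P k) (P j) x
    farther-midpoint-gap {x} {i} {j} {k} h f j≡i+h k≡j+f f≤h k≤i i<j = begin
      suc f                                  ≤⟨ farther-sum-bound h f i<j ⟩
      (h + f + d (P j) x) ∸ (r + h)          ≡⟨ cong (λ D → D + d (P j) x ∸ (r + h)) (sym (d-path-+ h f j≡i+h k≡j+f)) ⟩
      (d (P i) (P k) + d (P j) x) ∸ (r + h)  ≤⟨ ∸-≤-gap3 (r + h) B≤r+h C≤r+h ⟩
      fourPointGap d (P i) (P k) (P j) x     ∎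
      where
      open ≤-Reasoning
      r : ℕ
      r = d (P i) x
      B≤r+h : d (P i) (P j) + d (P k) x ≤ r + h
      B≤r+h = ≤-trans (+-mono-≤ (d-path-≤ h (sym j≡i+h)) k≤i) (≤-reflexive (+-comm h r))
      C≤r+h : r + d (P k) (P j) ≤ r + h
      C≤r+h = +-monoʳ-≤ r (≤-trans (≤-reflexive (d-sym (P k) (P j)))
                                   (≤-trans (d-path-≤ f (sym k≡j+f)) f≤h))

    midpoint-in-projection :
      ∀ {x} {i k : Fin (suc l)} → toℕ i < toℕ k → InProj G d l P x i → InProj G d l P x k →
      (∀ u v w y → suc (fourPointGap d u v w y + fourPointGap d u v w y) < d (P i) (P k)) →
      Σ (Fin (suc l)) λ j → toℕ i < toℕ j × toℕ j < toℕ k × InProj G d l P x j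
    midpoint-in-projection {x} {i} {k} i<k i∈Pr k∈Pr gap<
      with split-halves (d (P i) (P k)) (≤-trans (s≤s (s≤s z≤n)) (gap< x x x x))
    ... | h , f , D≡ , f≤h , h≤1+f = j , i<j , j<k , j∈Pr
      where
      k≡i+h+f : toℕ k ≡ toℕ i + suc h + suc f
      k≡i+h+f = begin
        toℕ k                             ≡⟨ sym (m+[n∸m]≡n (<⇒≤ i<k)) ⟩
        toℕ i + (toℕ k ∸ toℕ i)           ≡⟨ cong (λ m → toℕ i + m) (trans (sym (d-path (<⇒≤ i<k))) D≡) ⟩
        toℕ i + (suc h + suc f)           ≡⟨ sym (+-assoc (toℕ i) (suc h) (suc f)) ⟩
        toℕ i + suc h + suc f             ∎
        where open ≡-Reasoning
      j<1+l : toℕ i + suc h < suc l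
      j<1+l = ≤-<-trans (≤-trans (m≤m+n _ (suc f)) (≤-reflexive (sym k≡i+h+f))) (toℕ<n k)
      j : Fin (suc l)
      j = fromℕ< j<1+l
      j≡i+h : toℕ j ≡ toℕ i + suc h
      j≡i+h = toℕ-fromℕ< j<1+l
      k≡j+f : toℕ k ≡ toℕ j + suc f
      k≡j+f = trans k≡i+h+f (cong (_+ suc f) (sym j≡i+h))
      i<j : toℕ i < toℕ j
      i<j = subst (toℕ i <_) (sym j≡i+h) (m<m+n (toℕ i) z<s)
      j<k : toℕ j < toℕ k
      j<k = subst (toℕ j <_) (sym k≡j+f) (m<m+n (toℕ j) z<s)
      j∈Pr : InProj G d l P x j
      j∈Pr with d (P j) x ≤? d (P i) x
      ... | yes j≤i = λ j′ → ≤-trans j≤i (i∈Pr j′)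
      ... | no j≰i = ⊥-elim (halves-contradiction (s≤s h≤1+f)
          (farther-midpoint-gap (suc h) (suc f) j≡i+h k≡j+f (s≤s f≤h) (k∈Pr i) (≰⇒> j≰i))
          (subst (suc (gⱼ + gⱼ) <_) D≡ (gap< (P i) (P k) (P j) x)))
        where
        gⱼ : ℕ
        gⱼ = fourPointGap d (P i) (P k) (P j) x

lemma16 : (G : Graph) → Connected G →
          (d : Fin (n G) → Fin (n G) → ℕ) → IsDistance G d →
          (δ : ℚ) → Hyperbolic G d δ →
          ProjectionGapAtMost G d ((+ 4 / 1) * δ)
lemma16 G _ d isD δ hyp l P sp x i k i<k i∈Pr k∈Pr 4δ+1<D =
  midpoint-in-projection sp i<k i∈Pr k∈Pr
    (λ u v w y → double+1<-of-≤-2δ δ (fourPointGap d u v w y) _ (hyp u v w y) 4δ+1<D)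
  where open Distance G isD
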